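{- Let $F$ be an apexed $\ell$-frame and let $u,v\in V(F)$. Then some hole of $F$ contains both $u$ and $v$.
   Context: A hole is an induced cycle of length at least four; lengths count edges. A threshold graph is a graph with no induced four-vertex path, four-vertex cycle, or two-edge matching. $\ell$-frame for $\ell\ge5$ odd: take $k\ge3$ and distinct vertices $a_1,\dots,a_k,b_1,\dots,b_k$; for $1\le i\le k$ a path $P_i$ of length $(\ell-3)/2$ with ends $a_i,b_i$, pairwise vertex-disjoint; graphs $A$ on $\{a_1,\dots,a_k\}$ and $B$ on $\{b_1,\dots,b_k\}$ that are threshold graphs, with $b_ib_j$ an edge iff $a_ia_j$ is not ($i<j$), and each of $A,B$ either disconnected or two-connected. $F$ is the union of $A$, $B$ and $P_1,\dots,P_k$ (no other edges). Exactly one of $A,B$ is disconnected; the apexed $\ell$-frame is obtained by adding one new vertex (the apex) adjacent to exactly the vertices of the disconnected one. $\ell$-frame for $\ell\ge6$ even: integers $m\ge0$, $n\ge2$, $m+n\ge3$; distinct vertices $a_1,\dots,a_n,c_1,\dots,c_m,b_1,\dots,b_n,d_1,\dots,d_m$; pairwise vertex-disjoint paths $P_i$ ($1\le i\le n$) of length $\ell/2-2$ with ends $a_i,b_i$, and $Q_i$ ($1\le i\le m$) of length $\ell/2-1$ with ends $c_i,d_i$; graphs $A$ on $\{a_1,\dots,a_n,c_1,\dots,c_m\}$ and $B$ on $\{b_1,\dots,b_n,d_1,\dots,d_m\}$ in which $\{c_i\}$ and $\{d_i\}$ are cliques, $\{a_i\}$ and $\{b_i\}$ are stable sets, the bipartite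 graph between $\{a_i\}$ and $\{c_j\}$ in $A$ is a half-graph (no induced two-edge matching), $b_id_j$ is an edge iff $a_ic_j$ is not, some $a_i$ has degree zero in $A$ and some $b_i$ has degree zero in $B$. $F$ is the union of $A,B$ and all $P_i,Q_i$. The apexed $\ell$-frame is obtained by adding two new vertices $a_0$, adjacent to exactly the vertices of $A$, and $b_0$, adjacent to exactly the vertices of $B$. -}

module Defs where

open import Data.Nat using (ℕ; zero; suc; _+_; _∸_; _≤_; _%_; ⌊_/2⌋; _≡ᵇ_)
open import Data.Fin using (Fin; toℕ)
open import Data.Bool using (Bool; true; false; not; T; if_then_else_)
open import Data.Maybe using (Maybe; just; nothing)
open import Data.Sum using (_⊎_; inj₁; inj₂)
open import Data.Product using (Σ; ∃; ∃-syntax; _×_; _,_)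
open import Data.Empty using (⊥)
open import Relation.Nullary using (¬_)
open import Relation.Binary.PropositionalEquality using (_≡_; _≢_)
open import Relation.Binary.Construct.Closure.ReflexiveTransitive using (Star)
open import Function.Bundles using (_⇔_)

-- Generic graph notions.  A graph is a vertex type V with an edge
-- relation E : V → V → Set (in all uses below E is symmetric and
-- irreflexive).

CycAdj : (len : ℕ) → Fin len → Fin len → Set
CycAdj len i j =
  (toℕ j ≡ suc (toℕ i)) ⊎ (toℕ i ≡ suc (toℕ j)) ⊎
  ((toℕ i ≡ 0 × suc (toℕ j) ≡ len) ⊎ (toℕ j ≡ 0 × suc (toℕ i) ≡ len))

-- A hole: an induced cycle of length (number of edges = number of
-- vertices) at least four, given by an injective cyclic listing c of
-- its vertices; "induced" = two listed vertices are adjacent in the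
-- graph iff they are cyclically consecutive.
IsHole : {V : Set} (E : V → V → Set) (len : ℕ) (c : Fin len → V) → Set
IsHole E len c =
  4 ≤ len ×
  (∀ i j → c i ≡ c j → i ≡ j) ×
  (∀ i j → E (c i) (c j) ⇔ CycAdj len i j)

HoleThrough : {V : Set} (E : V → V → Set) (u v : V) → Set
HoleThrough {V} E u v =
  Σ ℕ λ len → Σ (Fin len → V) λ c →
    IsHole E len c × (∃[ i ] c i ≡ u) × (∃[ j ] c j ≡ v)

Distinct4 : {V : Set} → V → V → V → V → Set
Distinct4 w x y z = w ≢ x × w ≢ y × w ≢ z × x ≢ y × x ≢ z × y ≢ z

-- Threshold graph: no induced P4, C4 or 2K2.
Threshold : {V : Set} (E : V → V → Set) → Set
Threshold E = ∀ w x y z → Distinct4 w x y z →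
  ¬ (E w x × E x y × E y z × ¬ E w y × ¬ E w z × ¬ E x z) ×
  ¬ (E w x × E x y × E y z × E z w × ¬ E w y × ¬ E x z) ×
  ¬ (E w x × E y z × ¬ E w y × ¬ E w z × ¬ E x y × ¬ E x z)

Connected : {V : Set} (E : V → V → Set) → Set
Connected {V} E = (x y : V) → Star E x y

Disconnected : {V : Set} (E : V → V → Set) → Set
Disconnected E = ¬ Connected E

Del : {V : Set} (E : V → V → Set) (z : V) → V → V → Set
Del E z x y = E x y × x ≢ z × y ≢ z

TwoConnected : {V : Set} (E : V → V → Set) → Set
TwoConnected {V} E =
  (Σ V λ x → Σ V λ y → Σ V λ z → x ≢ y × x ≢ z × y ≢ z) ×
  Connected E ×
  (∀ z x y → x ≢ z → y ≢ z → Star (Del E z) x y)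

SideEdge : {V X : Set} (f : V → Maybe X) (R : X → X → Set) → V → V → Set
SideEdge f R x y = ∃[ p ] ∃[ q ] (f x ≡ just p × f y ≡ just q × R p q)

InImage : {V X : Set} (f : V → Maybe X) → V → Set
InImage f y = ∃[ p ] f y ≡ just p

Consec : {L : ℕ} → Fin L → Fin L → Set
Consec j j' = (toℕ j' ≡ suc (toℕ j)) ⊎ (toℕ j ≡ suc (toℕ j'))

-- Odd ℓ.  Paths P_i have length L = (ℓ-3)/2, vertices pv i 0 … pv i L,
-- with a_i = pv i 0 and b_i = pv i L.

module Odd (ℓ k : ℕ) (A : Fin k → Fin k → Bool) where

  L : ℕ
  L = ⌊ ℓ ∸ 3 /2⌋

  EA : Fin k → Fin k → Set
  EA i j = T (A i j)

  EB : Fin k → Fin k → Set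
  EB i j = i ≢ j × T (not (A i j))

  data V : Set where
    apex : V
    pv   : Fin k → Fin (suc L) → V

  toA : V → Maybe (Fin k)
  toA apex = nothing
  toA (pv i j) = if toℕ j ≡ᵇ 0 then just i else nothing

  toB : V → Maybe (Fin k)
  toB apex = nothing
  toB (pv i j) = if toℕ j ≡ᵇ L then just i else nothing

  PathE : V → V → Set
  PathE (pv i j) (pv i' j') = i ≡ i' × Consec j j'
  PathE _ _ = ⊥

  ApexE : V → V → Set
  ApexE apex y = (InImage toA y × Disconnected EA) ⊎ (InImage toB y × Disconnected EB)
  ApexE (pv _ _) _ = ⊥

  E : V → V → Set
  E x y = PathE x y ⊎ SideEdge toA EA x y ⊎ SideEdge toB EB x y ⊎ ApexE x y ⊎ ApexE y x

  record Hyp : Set where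
    field
      ℓ-odd    : ℓ % 2 ≡ 1
      ℓ≥5      : 5 ≤ ℓ
      k≥3      : 3 ≤ k
      A-irrefl : ∀ i → A i i ≡ false
      A-sym    : ∀ i j → A i j ≡ A j i
      A-thr    : Threshold EA
      B-thr    : Threshold EB
      A-conn   : Disconnected EA ⊎ TwoConnected EA
      B-conn   : Disconnected EB ⊎ TwoConnected EB
      exactly-one : (Disconnected EA × ¬ Disconnected EB) ⊎ (¬ Disconnected EA × Disconnected EB)

-- Even ℓ.  P_i (i < n) have length LP = ℓ/2 - 2 (a_i = pP i 0,
-- b_i = pP i LP), Q_i (i < m) have length LQ = ℓ/2 - 1 (c_i = pQ i 0,
-- d_i = pQ i LQ).  AC i j says a_i c_j is an edge of A.

module Even (ℓ n m : ℕ) (AC : Fin n → Fin m → Bool) where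

  LP : ℕ
  LP = ⌊ ℓ /2⌋ ∸ 2

  LQ : ℕ
  LQ = ⌊ ℓ /2⌋ ∸ 1

  -- vertices of A / B: inj₁ i = a_i (resp. b_i), inj₂ j = c_j (resp. d_j)
  AV : Set
  AV = Fin n ⊎ Fin m

  EA : AV → AV → Set
  EA (inj₁ i) (inj₁ i') = ⊥
  EA (inj₁ i) (inj₂ j)  = T (AC i j)
  EA (inj₂ j) (inj₁ i)  = T (AC i j)
  EA (inj₂ j) (inj₂ j') = j ≢ j'

  EB : AV → AV → Set
  EB (inj₁ i) (inj₁ i') = ⊥
  EB (inj₁ i) (inj₂ j)  = T (not (AC i j))
  EB (inj₂ j) (inj₁ i)  = T (not (AC i j))
  EB (inj₂ j) (inj₂ j') = j ≢ j'

  data V : Set where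
    apexA apexB : V
    pP : Fin n → Fin (suc LP) → V
    pQ : Fin m → Fin (suc LQ) → V

  toA : V → Maybe AV
  toA apexA = nothing
  toA apexB = nothing
  toA (pP i j) = if toℕ j ≡ᵇ 0 then just (inj₁ i) else nothing
  toA (pQ i j) = if toℕ j ≡ᵇ 0 then just (inj₂ i) else nothing

  toB : V → Maybe AV
  toB apexA = nothing
  toB apexB = nothing
  toB (pP i j) = if toℕ j ≡ᵇ LP then just (inj₁ i) else nothing
  toB (pQ i j) = if toℕ j ≡ᵇ LQ then just (inj₂ i) else nothing

  PathE : V → V → Set
  PathE (pP i j) (pP i' j') = i ≡ i' × Consec j j'
  PathE (pQ i j) (pQ i' j') = i ≡ i' × Consec j j'
  PathE _ _ = ⊥

  -- a_0 = apexA adjacent exactly to V(A), b_0 = apexB exactly to V(B)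
  ApexE : V → V → Set
  ApexE apexA y = InImage toA y
  ApexE apexB y = InImage toB y
  ApexE _ _ = ⊥

  E : V → V → Set
  E x y = PathE x y ⊎ SideEdge toA EA x y ⊎ SideEdge toB EB x y ⊎ ApexE x y ⊎ ApexE y x

  record Hyp : Set where
    field
      ℓ-even   : ℓ % 2 ≡ 0
      ℓ≥6      : 6 ≤ ℓ
      n≥2      : 2 ≤ n
      m+n≥3    : 3 ≤ m + n
      half     : ∀ i i' j j' →
                 ¬ (T (AC i j) × T (AC i' j') × ¬ T (AC i j') × ¬ T (AC i' j))
      a-deg0   : ∃[ i ] (∀ w → ¬ EA (inj₁ i) w)
      b-deg0   : ∃[ i ] (∀ w → ¬ EB (inj₁ i) w)

-- Every hole below is obtained in one way: two paths of the frame, one of them traversed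
-- backwards, are joined through an edge of A or of B into an induced path, and a vertex
-- adjacent to exactly the two outer ends of that path closes it into a hole.
--
-- Odd ℓ, with A disconnected (the case of B is symmetric): if a_i a_j is not an edge then
-- b_i b_j is, and the apex closes a_i … b_i b_j … a_j; if a_i a_j is an edge, then
-- b_i … a_i a_j … b_j is closed by b_h for any h with a_h adjacent to neither a_i nor a_j,
-- and such h exists because A is disconnected.
--
-- Even ℓ: two P-paths are joined through b_0 and closed by a_0; Q_j and P_i are joined through
-- d_j b_i or c_j a_i and closed by a_0 or b_0 respectively, a degree-zero a_i or b_i serving to
-- put Q_j on a hole with either apex; two Q-paths are joined at both ends by the clique edges
-- c_j c_j′ and d_j d_j′.

module Submission where

open import Defs
open import Data.Nat using (ℕ; zero; suc; _+_; _∸_; _≤_; _<_; z≤n; s≤s; ⌊_/2⌋; _≡ᵇ_)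
open import Data.Nat.Properties
  using (suc-injective; +-suc; +-comm; +-identityʳ; +-cancelˡ-≡; +-cancelʳ-≡; m+1+n≰m; m+n≮m;
         m∸n+n≡m; ≤-trans; m≤n+m; +-mono-≤; ≡ᵇ⇒≡; ≡⇒≡ᵇ)
open import Data.Fin using (Fin; zero; suc; toℕ; fromℕ; fromℕ<; opposite; _↑ˡ_; _↑ʳ_; splitAt)
open import Data.Fin.Properties
  using (toℕ<n; toℕ-fromℕ; toℕ-↑ˡ; toℕ-↑ʳ; join-splitAt; opposite-prop; opposite-involutive; 0≢1+n;
         ¬∀⟶∃¬; _≟_)
  renaming (suc-injective to Fin-suc-injective)
open import Data.Bool using (Bool; true; false; not; T; if_then_else_)
open import Data.Unit using (tt)
open import Data.Maybe using (Maybe; just; nothing)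
open import Data.Maybe.Properties using (just-injective)
open import Data.Product using (∃-syntax; _×_; _,_; proj₁; proj₂; uncurry)
open import Data.Sum using (_⊎_; inj₁; inj₂)
import Data.Sum as Sum
open import Data.Empty using (⊥-elim)
open import Relation.Nullary using (¬_; Dec; yes; no)
open import Relation.Nullary.Decidable using (T?; ¬?; _×-dec_; _⊎-dec_)
open import Relation.Binary.PropositionalEquality using (_≡_; _≢_; refl; sym; trans; cong; subst; subst₂)
open import Relation.Binary.Construct.Closure.ReflexiveTransitive as Star using (Star; ε; _◅_; _◅◅_)
open import Function using (_∘_; _∘′_; const)
open import Function.Bundles using (_⇔_; mk⇔; Equivalence)
open import Function.Properties.Equivalence using ()
  renaming (refl to ⇔-refl; sym to ⇔-sym; trans to ⇔-trans)
open import Data.Vec.Functional using (Vector; _∷_; _++_)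
open import Data.Vec.Functional.Properties using (lookup-++ˡ; lookup-++ʳ)

private variable
  m n N : ℕ

-- Positions on a path

-- Consec i j unfolds to ConsecNat (toℕ i) (toℕ j).
ConsecNat : ℕ → ℕ → Set
ConsecNat a b = b ≡ suc a ⊎ a ≡ suc b

ConsecNat-sym : ∀ {a b} → ConsecNat a b → ConsecNat b a
ConsecNat-sym = Sum.swap

ConsecNat-suc : ∀ {a b} → ConsecNat (suc a) (suc b) ⇔ ConsecNat a b
ConsecNat-suc = mk⇔ (Sum.map suc-injective suc-injective) (Sum.map (cong suc) (cong suc))

ConsecNat-irrefl : ∀ {a} → ¬ ConsecNat a a
ConsecNat-irrefl (inj₁ ())
ConsecNat-irrefl (inj₂ ())

ConsecNat-+ˡ : ∀ m {a b} → ConsecNat (m + a) (m + b) ⇔ ConsecNat a b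
ConsecNat-+ˡ zero    = ⇔-refl
ConsecNat-+ˡ (suc m) = ⇔-trans ConsecNat-suc (ConsecNat-+ˡ m)

ConsecNat-complement : ∀ {a b c d} → a + b ≡ c + d → ConsecNat a c ⇔ ConsecNat d b
ConsecNat-complement {a} {b} {c} {d} eq =
  mk⇔ (swap eq) (swap (trans (+-comm d c) (trans (sym eq) (+-comm a b))))
  where
  swap : ∀ {a b c d} → a + b ≡ c + d → ConsecNat a c → ConsecNat d b
  swap {a} {b} {d = d} eq (inj₁ refl) = inj₁ (+-cancelˡ-≡ a b (suc d) (trans eq (sym (+-suc a d))))
  swap {b = b} {c} {d} eq (inj₂ refl) = inj₂ (+-cancelˡ-≡ c d (suc b) (trans (sym eq) (sym (+-suc c b))))

ConsecNat-across : ∀ {a} m b → a < m → ConsecNat a (m + b) ⇔ (suc a ≡ m × b ≡ 0)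
ConsecNat-across {a} m b a<m = mk⇔ (to b) from
  where
  to : ∀ b → ConsecNat a (m + b) → suc a ≡ m × b ≡ 0
  to zero    (inj₁ e) = trans (sym e) (+-identityʳ m) , refl
  to (suc b) (inj₁ e) = ⊥-elim (m+1+n≰m m (subst (_≤ m) (sym e) a<m))
  to b       (inj₂ e) = ⊥-elim (m+n≮m m (suc b) (subst (_< m) (trans e (sym (+-suc m b))) a<m))
  from : suc a ≡ m × b ≡ 0 → ConsecNat a (m + b)
  from (e , refl) = inj₁ (trans (+-identityʳ m) (sym e))

IsFirst : Fin N → Set
IsFirst s = toℕ s ≡ 0

IsLast : Fin N → Set
IsLast {N} s = suc (toℕ s) ≡ N

Consec⇔ConsecNat : {i j : Fin N} {a b : ℕ} → toℕ i ≡ a → toℕ j ≡ b →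
                   Consec i j ⇔ ConsecNat a b
Consec⇔ConsecNat i≡a j≡b =
  mk⇔ (subst₂ ConsecNat i≡a j≡b) (subst₂ ConsecNat (sym i≡a) (sym j≡b))

Consec-zero-suc : {s : Fin N} → Consec zero (suc s) ⇔ IsFirst s
Consec-zero-suc = mk⇔ (λ { (inj₁ e) → suc-injective e ; (inj₂ ()) }) (inj₁ ∘ cong suc)

Consec-↑ˡ : {s t : Fin m} → Consec (s ↑ˡ n) (t ↑ˡ n) ⇔ Consec s t
Consec-↑ˡ {n = n} {s} {t} = Consec⇔ConsecNat (toℕ-↑ˡ s n) (toℕ-↑ˡ t n)

Consec-↑ʳ : {s t : Fin n} → Consec (m ↑ʳ s) (m ↑ʳ t) ⇔ Consec s t
Consec-↑ʳ {m = m} {s = s} {t} =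
  ⇔-trans (Consec⇔ConsecNat (toℕ-↑ʳ m s) (toℕ-↑ʳ m t)) (ConsecNat-+ˡ m)

Consec-↑ˡ-↑ʳ : {s : Fin m} {t : Fin n} → Consec (s ↑ˡ n) (m ↑ʳ t) ⇔ (IsLast s × IsFirst t)
Consec-↑ˡ-↑ʳ {m} {n} {s} {t} =
  ⇔-trans (Consec⇔ConsecNat (toℕ-↑ˡ s n) (toℕ-↑ʳ m t)) (ConsecNat-across m (toℕ t) (toℕ<n s))

opposite-sum : (s : Fin n) → toℕ (opposite s) + suc (toℕ s) ≡ n
opposite-sum s = trans (cong (_+ suc (toℕ s)) (opposite-prop s)) (m∸n+n≡m (toℕ<n s))

opposite-injective : (s t : Fin n) → opposite s ≡ opposite t → s ≡ t
opposite-injective s t e = trans (sym (opposite-involutive s)) (trans (cong opposite e) (opposite-involutive t))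

Consec-opposite : {s t : Fin n} → Consec (opposite s) (opposite t) ⇔ Consec s t
Consec-opposite {s = s} {t} = ⇔-trans
  (ConsecNat-complement (trans (opposite-sum s) (sym (opposite-sum t))))
  (mk⇔ (ConsecNat-sym ∘ Equivalence.to ConsecNat-suc) (Equivalence.from ConsecNat-suc ∘ ConsecNat-sym))

IsFirst-opposite : {s : Fin n} → IsFirst (opposite s) ⇔ IsLast s
IsFirst-opposite {n} {s} = mk⇔
  (λ e → subst (λ o → o + suc (toℕ s) ≡ n) e (opposite-sum s))
  (λ e → +-cancelʳ-≡ (suc (toℕ s)) (toℕ (opposite s)) 0 (trans (opposite-sum s) (sym e)))

IsLast-opposite : {s : Fin n} → IsLast (opposite s) ⇔ IsFirst s
IsLast-opposite {s = s} = ⇔-trans (⇔-sym IsFirst-opposite)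
  (mk⇔ (subst IsFirst (opposite-involutive s)) (subst IsFirst (sym (opposite-involutive s))))

IsFirst-↑ˡ : {s : Fin m} → IsFirst (s ↑ˡ n) ⇔ IsFirst s
IsFirst-↑ˡ {n = n} {s} = mk⇔ (trans (sym (toℕ-↑ˡ s n))) (trans (toℕ-↑ˡ s n))

IsLast-↑ʳ : {t : Fin n} → IsLast (m ↑ʳ t) ⇔ IsLast t
IsLast-↑ʳ {n} {m} {t} = mk⇔
  (λ e → +-cancelˡ-≡ m (suc (toℕ t)) n
           (trans (+-suc m (toℕ t)) (trans (cong suc (sym (toℕ-↑ʳ m t))) e)))
  (λ e → trans (cong suc (toℕ-↑ʳ m t)) (trans (sym (+-suc m (toℕ t))) (cong (m +_) e)))

¬IsLast-↑ˡ : 1 ≤ n → (s : Fin m) → ¬ IsLast (s ↑ˡ n)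
¬IsLast-↑ˡ {n = suc n} {m} _ s e =
  m+1+n≰m m (subst (_≤ m) (trans (cong suc (sym (toℕ-↑ˡ s (suc n)))) e) (toℕ<n s))

¬IsFirst-↑ʳ : 1 ≤ m → (t : Fin n) → ¬ IsFirst (m ↑ʳ t)
¬IsFirst-↑ʳ {m = suc m} _ t ()

IsLast-suc : {s : Fin N} → IsLast {suc N} (suc s) ⇔ IsLast s
IsLast-suc = mk⇔ suc-injective (cong suc)

¬IsLast-zero : ∀ {L} → 1 ≤ L → ¬ IsLast {suc L} zero
¬IsLast-zero (s≤s _) ()

IsLast-fromℕ : ∀ L → IsLast (fromℕ L)
IsLast-fromℕ L = cong suc (toℕ-fromℕ L)

¬IsFirst-fromℕ : ∀ {L} → 1 ≤ L → ¬ IsFirst (fromℕ L)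
¬IsFirst-fromℕ (s≤s _) ()

CycAdj-sym : {i j : Fin N} → CycAdj N i j → CycAdj N j i
CycAdj-sym (inj₁ e)                = inj₂ (inj₁ e)
CycAdj-sym (inj₂ (inj₁ e))         = inj₁ e
CycAdj-sym (inj₂ (inj₂ (inj₁ e)))  = inj₂ (inj₂ (inj₂ e))
CycAdj-sym (inj₂ (inj₂ (inj₂ e)))  = inj₂ (inj₂ (inj₁ e))

¬CycAdj-zero-zero : 1 ≤ N → ¬ CycAdj (suc N) zero zero
¬CycAdj-zero-zero (s≤s _) (inj₂ (inj₂ (inj₁ (_ , ()))))
¬CycAdj-zero-zero (s≤s _) (inj₂ (inj₂ (inj₂ (_ , ()))))

CycAdj-zero-suc : {s : Fin N} → CycAdj (suc N) zero (suc s) ⇔ (IsFirst s ⊎ IsLast s)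
CycAdj-zero-suc = mk⇔ to from
  where
  to : ∀ {s} → CycAdj (suc N) zero (suc s) → IsFirst s ⊎ IsLast s
  to (inj₁ e)                      = inj₁ (suc-injective e)
  to (inj₂ (inj₂ (inj₁ (_ , e))))  = inj₂ (suc-injective e)
  from : ∀ {s} → IsFirst s ⊎ IsLast s → CycAdj (suc N) zero (suc s)
  from (inj₁ e) = inj₁ (cong suc e)
  from (inj₂ e) = inj₂ (inj₂ (inj₁ (refl , cong suc e)))

CycAdj-suc : {s t : Fin N} → CycAdj (suc N) (suc s) (suc t) ⇔ Consec s t
CycAdj-suc = mk⇔ to from
  where
  to : ∀ {s t} → CycAdj (suc N) (suc s) (suc t) → Consec s t
  to (inj₁ e)        = inj₁ (suc-injective e)
  to (inj₂ (inj₁ e)) = inj₂ (suc-injective e)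
  to (inj₂ (inj₂ (inj₁ (() , _))))
  to (inj₂ (inj₂ (inj₂ (() , _))))
  from : ∀ {s t} → Consec s t → CycAdj (suc N) (suc s) (suc t)
  from (inj₁ e) = inj₁ (cong suc e)
  from (inj₂ e) = inj₂ (inj₁ (cong suc e))

data Split (m n : ℕ) : Fin (m + n) → Set where
  left  : (s : Fin m) → Split m n (s ↑ˡ n)
  right : (t : Fin n) → Split m n (m ↑ʳ t)

split : ∀ m n (i : Fin (m + n)) → Split m n i
split m n i with splitAt m i | join-splitAt m n i
... | inj₁ s | refl = left s
... | inj₂ t | refl = right t

record _∈ᵥ_ {A : Set} (x : A) {n : ℕ} (c : Vector A n) : Set where
  constructor found
  field
    position        : Fin n
    lookup-position : c position ≡ x

_⊆ᵥ_ : {A : Set} → Vector A m → Vector A n → Set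
g ⊆ᵥ c = ∀ {x} → x ∈ᵥ g → x ∈ᵥ c

module _ {A : Set} where

  ∈-self : (g : Vector A n) (s : Fin n) → g s ∈ᵥ g
  ∈-self g s = found s refl

  ∈-here : {x : A} {c : Vector A n} → x ∈ᵥ (x ∷ c)
  ∈-here = found zero refl

  ∈-there : {x : A} {c : Vector A n} → c ⊆ᵥ (x ∷ c)
  ∈-there (found i e) = found (suc i) e

  ∈-reverse : {g : Vector A n} → g ⊆ᵥ (g ∘ opposite)
  ∈-reverse {g = g} (found s e) = found (opposite s) (trans (cong g (opposite-involutive s)) e)

  ∈-++ˡ : (g : Vector A m) (h : Vector A n) → g ⊆ᵥ (g ++ h)
  ∈-++ˡ {n = n} g h (found s e) = found (s ↑ˡ n) (trans (lookup-++ˡ g h s) e)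

  ∈-++ʳ : (g : Vector A m) (h : Vector A n) → h ⊆ᵥ (g ++ h)
  ∈-++ʳ {m = m} g h (found t e) = found (m ↑ʳ t) (trans (lookup-++ʳ g h t) e)

  ⊆-head-tail : {g : Vector A (suc n)} {c : Vector A m} →
                g zero ∈ᵥ c → (g ∘ suc) ⊆ᵥ c → g ⊆ᵥ c
  ⊆-head-tail head∈ tail⊆ (found zero    refl) = head∈
  ⊆-head-tail head∈ tail⊆ (found (suc i) e)    = tail⊆ (found i e)

module _ {A : Set} {g : Vector A m} {h : Vector A n} where

  ++-all : {P : A → Set} → (∀ s → P (g s)) → (∀ t → P (h t)) → ∀ i → P ((g ++ h) i)
  ++-all {P} Pg Ph i with split m n i
  ... | left s  = subst P (sym (lookup-++ˡ g h s)) (Pg s)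
  ... | right t = subst P (sym (lookup-++ʳ g h t)) (Ph t)

  ++-ends : {P : A → Set} → 1 ≤ m → 1 ≤ n →
            (∀ s → P (g s) ⇔ IsFirst s) → (∀ t → P (h t) ⇔ IsLast t) →
            ∀ i → P ((g ++ h) i) ⇔ (IsFirst i ⊎ IsLast i)
  ++-ends 1≤m 1≤n Pg Ph i with split m n i
  ... | left s rewrite lookup-++ˡ g h s =
    mk⇔ (inj₁ ∘ Equivalence.from IsFirst-↑ˡ ∘ Equivalence.to (Pg s))
        (λ { (inj₁ e) → Equivalence.from (Pg s) (Equivalence.to IsFirst-↑ˡ e)
           ; (inj₂ e) → ⊥-elim (¬IsLast-↑ˡ 1≤n s e) })
  ... | right t rewrite lookup-++ʳ g h t =
    mk⇔ (inj₂ ∘ Equivalence.from IsLast-↑ʳ ∘ Equivalence.to (Ph t))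
        (λ { (inj₁ e) → ⊥-elim (¬IsFirst-↑ʳ 1≤m t e)
           ; (inj₂ e) → Equivalence.from (Ph t) (Equivalence.to IsLast-↑ʳ e) })

-- Induced paths and holes

module InducedPaths {V : Set} (E : V → V → Set)
  (E-sym : ∀ {x y} → E x y → E y x) (E-irrefl : ∀ {x} → ¬ E x x) where

  record IsInducedPath (g : Vector V N) : Set where
    field
      injective   : ∀ s t → g s ≡ g t → s ≡ t
      edge⇔consec : ∀ s t → E (g s) (g t) ⇔ Consec s t
  open IsInducedPath

  reindex : ∀ {M} {g : Vector V N} (σ : Fin M → Fin N) → (∀ s t → σ s ≡ σ t → s ≡ t) →
            (∀ s t → Consec (σ s) (σ t) ⇔ Consec s t) → IsInducedPath g → IsInducedPath (g ∘ σ)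
  reindex σ σ-injective σ-consec p = record
    { injective   = λ s t → σ-injective s t ∘ injective p (σ s) (σ t)
    ; edge⇔consec = λ s t → ⇔-trans (edge⇔consec p (σ s) (σ t)) (σ-consec s t)
    }

  reverse : {g : Vector V N} → IsInducedPath g → IsInducedPath (g ∘ opposite)
  reverse = reindex opposite opposite-injective (λ _ _ → Consec-opposite)

  tail : {g : Vector V (suc N)} → IsInducedPath g → IsInducedPath (g ∘ suc)
  tail = reindex suc (λ _ _ → Fin-suc-injective) (λ _ _ → ConsecNat-suc)

  private
    ∷-injective : ∀ {x} {g : Vector V N} → (∀ s → x ≢ g s) → (∀ s t → g s ≡ g t → s ≡ t) →
                  ∀ i j → (x ∷ g) i ≡ (x ∷ g) j → i ≡ j
    ∷-injective x∉g g-inj zero    zero    _ = refl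
    ∷-injective x∉g g-inj zero    (suc t) e = ⊥-elim (x∉g t e)
    ∷-injective x∉g g-inj (suc s) zero    e = ⊥-elim (x∉g s (sym e))
    ∷-injective x∉g g-inj (suc s) (suc t) e = cong suc (g-inj s t e)

    ∷-edges : ∀ {x} {g : Vector V N} {R : Fin (suc N) → Fin (suc N) → Set} →
              (∀ {i j} → R i j → R j i) → ¬ R zero zero →
              (∀ s → E x (g s) ⇔ R zero (suc s)) → (∀ s t → E (g s) (g t) ⇔ R (suc s) (suc t)) →
              ∀ i j → E ((x ∷ g) i) ((x ∷ g) j) ⇔ R i j
    ∷-edges R-sym ¬R00 Ex Eg zero    zero    = mk⇔ (⊥-elim ∘ E-irrefl) (⊥-elim ∘ ¬R00)
    ∷-edges R-sym ¬R00 Ex Eg zero    (suc t) = Ex t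
    ∷-edges R-sym ¬R00 Ex Eg (suc s) zero    =
      mk⇔ (R-sym ∘ Equivalence.to (Ex s) ∘ E-sym) (E-sym ∘ Equivalence.from (Ex s) ∘ R-sym)
    ∷-edges R-sym ¬R00 Ex Eg (suc s) (suc t) = Eg s t

  ∷-inducedPath : ∀ {x} {g : Vector V N} → (∀ s → x ≢ g s) → (∀ s → E x (g s) ⇔ IsFirst s) →
                  IsInducedPath g → IsInducedPath (x ∷ g)
  ∷-inducedPath x∉g Ex p = record
    { injective   = ∷-injective x∉g (injective p)
    ; edge⇔consec = ∷-edges ConsecNat-sym ConsecNat-irrefl
        (λ s → ⇔-trans (Ex s) (⇔-sym Consec-zero-suc))
        (λ s t → ⇔-trans (edge⇔consec p s t) (⇔-sym ConsecNat-suc))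
    }

  ∷-isHole : ∀ {x} {g : Vector V N} → 3 ≤ N → (∀ s → x ≢ g s) →
             (∀ s → E x (g s) ⇔ (IsFirst s ⊎ IsLast s)) → IsInducedPath g →
             IsHole E (suc N) (x ∷ g)
  ∷-isHole N≥3 x∉g Ex p =
    s≤s N≥3 ,
    ∷-injective x∉g (injective p) ,
    ∷-edges CycAdj-sym (¬CycAdj-zero-zero (≤-trans (s≤s z≤n) N≥3))
      (λ s → ⇔-trans (Ex s) (⇔-sym CycAdj-zero-suc))
      (λ s t → ⇔-trans (edge⇔consec p s t) (⇔-sym CycAdj-suc))

  ++-inducedPath : {g : Vector V m} {h : Vector V n} → (∀ s t → g s ≢ h t) →
                   (∀ s t → E (g s) (h t) ⇔ (IsLast s × IsFirst t)) →
                   IsInducedPath g → IsInducedPath h → IsInducedPath (g ++ h)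
  ++-inducedPath {m} {n} {g} {h} g∩h Egh p q = record { injective = inj ; edge⇔consec = edges }
    where
    inj : ∀ i j → (g ++ h) i ≡ (g ++ h) j → i ≡ j
    inj i j with split m n i | split m n j
    ... | left s  | left s′  rewrite lookup-++ˡ g h s | lookup-++ˡ g h s′ =
      cong (_↑ˡ n) ∘ injective p s s′
    ... | left s  | right t  rewrite lookup-++ˡ g h s | lookup-++ʳ g h t = ⊥-elim ∘ g∩h s t
    ... | right t | left s   rewrite lookup-++ʳ g h t | lookup-++ˡ g h s = ⊥-elim ∘ g∩h s t ∘ sym
    ... | right t | right t′ rewrite lookup-++ʳ g h t | lookup-++ʳ g h t′ =
      cong (m ↑ʳ_) ∘ injective q t t′
    edges : ∀ i j → E ((g ++ h) i) ((g ++ h) j) ⇔ Consec i j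
    edges i j with split m n i | split m n j
    ... | left s  | left s′  rewrite lookup-++ˡ g h s | lookup-++ˡ g h s′ =
      ⇔-trans (edge⇔consec p s s′) (⇔-sym Consec-↑ˡ)
    ... | left s  | right t  rewrite lookup-++ˡ g h s | lookup-++ʳ g h t =
      ⇔-trans (Egh s t) (⇔-sym Consec-↑ˡ-↑ʳ)
    ... | right t | left s   rewrite lookup-++ʳ g h t | lookup-++ˡ g h s =
      mk⇔ (ConsecNat-sym ∘ Equivalence.from Consec-↑ˡ-↑ʳ ∘ Equivalence.to (Egh s t) ∘ E-sym)
          (E-sym ∘ Equivalence.from (Egh s t) ∘ Equivalence.to Consec-↑ˡ-↑ʳ ∘ ConsecNat-sym)
    ... | right t | right t′ rewrite lookup-++ʳ g h t | lookup-++ʳ g h t′ =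
      ⇔-trans (edge⇔consec q t t′) (⇔-sym Consec-↑ʳ)

  record HoleContaining (x : V) (g : Vector V m) (h : Vector V n) : Set where
    field
      {len}  : ℕ
      cycle  : Vector V len
      isHole : IsHole E len cycle
      ∋x     : x ∈ᵥ cycle
      ⊇g     : g ⊆ᵥ cycle
      ⊇h     : h ⊆ᵥ cycle

  ∷-++-hole : ∀ {x} {g : Vector V m} {h : Vector V n} → 1 ≤ m → 1 ≤ n → 3 ≤ m + n →
              (∀ s → x ≢ g s) → (∀ t → x ≢ h t) →
              (∀ s → E x (g s) ⇔ IsFirst s) → (∀ t → E x (h t) ⇔ IsLast t) →
              IsInducedPath (g ++ h) → HoleContaining x g h
  ∷-++-hole {x = x} {g} {h} 1≤m 1≤n size x∉g x∉h Exg Exh p = record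
    { cycle  = x ∷ (g ++ h)
    ; isHole = ∷-isHole size (++-all {P = x ≢_} x∉g x∉h) (++-ends {P = E x} 1≤m 1≤n Exg Exh) p
    ; ∋x     = ∈-here
    ; ⊇g     = ∈-there ∘ ∈-++ˡ g h
    ; ⊇h     = ∈-there ∘ ∈-++ʳ g h
    }

  reverseˡ : ∀ {x} {g : Vector V m} {h : Vector V n} →
             HoleContaining x (g ∘ opposite) h → HoleContaining x g h
  reverseˡ H = record { cycle = cycle ; isHole = isHole ; ∋x = ∋x ; ⊇g = ⊇g ∘ ∈-reverse ; ⊇h = ⊇h }
    where open HoleContaining H

  reverseʳ : ∀ {x} {g : Vector V m} {h : Vector V n} →
             HoleContaining x g (h ∘ opposite) → HoleContaining x g h
  reverseʳ H = record { cycle = cycle ; isHole = isHole ; ∋x = ∋x ; ⊇g = ⊇g ; ⊇h = ⊇h ∘ ∈-reverse }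
    where open HoleContaining H

  holeThrough : ∀ {x} {g : Vector V m} {h : Vector V n} (H : HoleContaining x g h) {u v} →
                u ∈ᵥ HoleContaining.cycle H → v ∈ᵥ HoleContaining.cycle H → HoleThrough E u v
  holeThrough H (found i e) (found j e′) = _ , _ , HoleContaining.isHole H , (i , e) , (j , e′)

  holeThrough-sym : ∀ {u v} → HoleThrough E u v → HoleThrough E v u
  holeThrough-sym (len , c , hole , u∈ , v∈) = len , c , hole , v∈ , u∈

-- Graphs shaped like a frame

if-≡ᵇ-just : ∀ {X : Set} c b {x p : X} →
  (if c ≡ᵇ b then just x else nothing) ≡ just p ⇔ (x ≡ p × c ≡ b)
if-≡ᵇ-just c b = mk⇔ to from
  where
  to : ∀ {X : Set} {x p : X} → (if c ≡ᵇ b then just x else nothing) ≡ just p → x ≡ p × c ≡ b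
  to e with c ≡ᵇ b in eq
  ... | true = just-injective e , ≡ᵇ⇒≡ c b (subst T (sym eq) tt)
  from : ∀ {X : Set} {x p : X} → x ≡ p × c ≡ b → (if c ≡ᵇ b then just x else nothing) ≡ just p
  from (refl , e) with c ≡ᵇ b in eq
  ... | true  = refl
  ... | false = ⊥-elim (subst T eq (≡⇒≡ᵇ c b e))

if-first-just : ∀ {X : Set} {N} (s : Fin N) {x p : X} →
  (if toℕ s ≡ᵇ 0 then just x else nothing) ≡ just p ⇔ (x ≡ p × IsFirst s)
if-first-just s = if-≡ᵇ-just (toℕ s) 0

if-last-just : ∀ {X : Set} {L} (s : Fin (suc L)) {x p : X} →
  (if toℕ s ≡ᵇ L then just x else nothing) ≡ just p ⇔ (x ≡ p × IsLast s)
if-last-just {L = L} s = ⇔-trans (if-≡ᵇ-just (toℕ s) L)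
  (mk⇔ (λ (e , s≡L) → e , cong suc s≡L) (λ (e , s+1≡L+1) → e , suc-injective s+1≡L+1))

T-not : ∀ b → T (not b) ⇔ (¬ T b)
T-not true  = mk⇔ (λ ()) (λ f → f tt)
T-not false = mk⇔ (λ _ ()) (λ _ → tt)

¬T-not⇒T : ∀ b → ¬ T (not b) → T b
¬T-not⇒T true  _ = tt
¬T-not⇒T false f = ⊥-elim (f tt)

pattern path-edge e  = inj₁ e
pattern A-edge e     = inj₂ (inj₁ e)
pattern B-edge e     = inj₂ (inj₂ (inj₁ e))
pattern apex-edgeˡ e = inj₂ (inj₂ (inj₂ (inj₁ e)))
pattern apex-edgeʳ e = inj₂ (inj₂ (inj₂ (inj₂ e)))

EndAdjacent : {I : Set} (EA EB : I → I → Set) {M N : ℕ} → I → I → Fin M → Fin N → Set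
EndAdjacent EA EB u w s t = (IsFirst s × IsFirst t × EA u w) ⊎ (IsLast s × IsLast t × EB u w)

-- The edge relation E of both frames is definitionally Edge for the frame's own data.
module FrameEdges {V X : Set} (PathE : V → V → Set) (toA : V → Maybe X) (EA : X → X → Set)
  (toB : V → Maybe X) (EB : X → X → Set) (ApexE : V → V → Set) where

  Edge : V → V → Set
  Edge x y = PathE x y ⊎ SideEdge toA EA x y ⊎ SideEdge toB EB x y ⊎ ApexE x y ⊎ ApexE y x

  Edge-sym : (∀ {x y} → PathE x y → PathE y x) → (∀ {p q} → EA p q → EA q p) →
             (∀ {p q} → EB p q → EB q p) → ∀ {x y} → Edge x y → Edge y x
  Edge-sym P-sym A-sym B-sym (path-edge e)                  = path-edge (P-sym e)
  Edge-sym P-sym A-sym B-sym (A-edge (p , q , fx , fy , r)) = A-edge (q , p , fy , fx , A-sym r)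
  Edge-sym P-sym A-sym B-sym (B-edge (p , q , fx , fy , r)) = B-edge (q , p , fy , fx , B-sym r)
  Edge-sym P-sym A-sym B-sym (apex-edgeˡ e)                 = apex-edgeʳ e
  Edge-sym P-sym A-sym B-sym (apex-edgeʳ e)                 = apex-edgeˡ e

  Edge-irrefl : (∀ {x} → ¬ PathE x x) → (∀ p → ¬ EA p p) → (∀ q → ¬ EB q q) →
                (∀ {x} → ¬ ApexE x x) → ∀ {x} → ¬ Edge x x
  Edge-irrefl P-irr A-irr B-irr X-irr (path-edge e) = P-irr e
  Edge-irrefl P-irr A-irr B-irr X-irr (A-edge (p , q , fx , fy , r))
    rewrite just-injective (trans (sym fx) fy) = A-irr q r
  Edge-irrefl P-irr A-irr B-irr X-irr (B-edge (p , q , fx , fy , r))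
    rewrite just-injective (trans (sym fx) fy) = B-irr q r
  Edge-irrefl P-irr A-irr B-irr X-irr (apex-edgeˡ e) = X-irr e
  Edge-irrefl P-irr A-irr B-irr X-irr (apex-edgeʳ e) = X-irr e

  module OnPaths (EA-irrefl : ∀ p → ¬ EA p p) (EB-irrefl : ∀ q → ¬ EB q q)
    {len : X → ℕ} (path : (u : X) → Vector V (suc (len u)))
    (PathE-same : ∀ {u s t} → PathE (path u s) (path u t) ⇔ Consec s t)
    (PathE-distinct : ∀ {u w s t} → u ≢ w → ¬ PathE (path u s) (path w t))
    (toA-path : ∀ u s {p} → toA (path u s) ≡ just p ⇔ (u ≡ p × IsFirst s))
    (toB-path : ∀ u s {q} → toB (path u s) ≡ just q ⇔ (u ≡ q × IsLast s))
    (¬ApexE-path : ∀ u s y → ¬ ApexE (path u s) y) where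

    private
      first⁻ : ∀ u s {p} → toA (path u s) ≡ just p → u ≡ p × IsFirst s
      first⁻ u s = Equivalence.to (toA-path u s)

      first⁺ : ∀ u s → IsFirst s → toA (path u s) ≡ just u
      first⁺ u s s₀ = Equivalence.from (toA-path u s) (refl , s₀)

      last⁻ : ∀ u s {q} → toB (path u s) ≡ just q → u ≡ q × IsLast s
      last⁻ u s = Equivalence.to (toB-path u s)

      last⁺ : ∀ u s → IsLast s → toB (path u s) ≡ just u
      last⁺ u s sₗ = Equivalence.from (toB-path u s) (refl , sₗ)

    Edge-path-same : ∀ {u s t} → Edge (path u s) (path u t) ⇔ Consec s t
    Edge-path-same {u} = mk⇔ to (path-edge ∘′ Equivalence.from PathE-same)
      where
      to : ∀ {s t} → Edge (path u s) (path u t) → Consec s t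
      to (path-edge e) = Equivalence.to PathE-same e
      to {s} {t} (A-edge (_ , _ , fs , ft , r)) with first⁻ u s fs | first⁻ u t ft
      ... | refl , _ | refl , _ = ⊥-elim (EA-irrefl u r)
      to {s} {t} (B-edge (_ , _ , fs , ft , r)) with last⁻ u s fs | last⁻ u t ft
      ... | refl , _ | refl , _ = ⊥-elim (EB-irrefl u r)
      to {s} (apex-edgeˡ e)     = ⊥-elim (¬ApexE-path u s _ e)
      to {t = t} (apex-edgeʳ e) = ⊥-elim (¬ApexE-path u t _ e)

    Edge-path-distinct : ∀ {u w s t} → u ≢ w → Edge (path u s) (path w t) ⇔ EndAdjacent EA EB u w s t
    Edge-path-distinct {u} {w} u≢w = mk⇔ to from
      where
      to : ∀ {s t} → Edge (path u s) (path w t) → EndAdjacent EA EB u w s t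
      to (path-edge e) = ⊥-elim (PathE-distinct u≢w e)
      to {s} {t} (A-edge (_ , _ , fs , ft , r)) with first⁻ u s fs | first⁻ w t ft
      ... | refl , s₀ | refl , t₀ = inj₁ (s₀ , t₀ , r)
      to {s} {t} (B-edge (_ , _ , fs , ft , r)) with last⁻ u s fs | last⁻ w t ft
      ... | refl , sₗ | refl , tₗ = inj₂ (sₗ , tₗ , r)
      to {s} (apex-edgeˡ e)     = ⊥-elim (¬ApexE-path u s _ e)
      to {t = t} (apex-edgeʳ e) = ⊥-elim (¬ApexE-path w t _ e)
      from : ∀ {s t} → EndAdjacent EA EB u w s t → Edge (path u s) (path w t)
      from {s} {t} (inj₁ (s₀ , t₀ , r)) = A-edge (u , w , first⁺ u s s₀ , first⁺ w t t₀ , r)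
      from {s} {t} (inj₂ (sₗ , tₗ , r)) = B-edge (u , w , last⁺ u s sₗ , last⁺ w t tₗ , r)

-- Disconnected graphs

module _ {k : ℕ} {R : Fin k → Fin k → Set} (R-sym : ∀ {i j} → R i j → R j i)
  (R? : ∀ i j → Dec (R i j)) where

  private
    connected-via : (i : Fin k) → (∀ x → Star R x i) → Connected R
    connected-via i reach x y = reach x ◅◅ Star.reverse R-sym (reach y)

  disconnected⇒non-neighbour : Disconnected R → ∀ i → ∃[ j ] (j ≢ i × ¬ R i j)
  disconnected⇒non-neighbour disc i
    with ¬∀⟶∃¬ k (λ j → j ≡ i ⊎ R i j) (λ j → (j ≟ i) ⊎-dec R? i j)
           (disc ∘′ connected-via i ∘′ reach)
    where
    reach : (∀ x → x ≡ i ⊎ R i x) → ∀ x → Star R x i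
    reach near x with near x
    ... | inj₁ refl = ε
    ... | inj₂ r    = R-sym r ◅ ε
  ... | j , far = j , far ∘′ inj₁ , far ∘′ inj₂

  disconnected⇒common-non-neighbour : Disconnected R → ∀ {i j} → R i j →
    ∃[ h ] (h ≢ i × h ≢ j × ¬ R i h × ¬ R j h)
  disconnected⇒common-non-neighbour disc {i} {j} rij
    with ¬∀⟶∃¬ k (λ h → h ≡ i ⊎ h ≡ j ⊎ R i h ⊎ R j h)
           (λ h → (h ≟ i) ⊎-dec (h ≟ j) ⊎-dec R? i h ⊎-dec R? j h)
           (disc ∘′ connected-via i ∘′ reach)
    where
    reach : (∀ x → x ≡ i ⊎ x ≡ j ⊎ R i x ⊎ R j x) → ∀ x → Star R x i
    reach near x with near x
    ... | inj₁ refl               = ε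
    ... | inj₂ (inj₁ refl)        = R-sym rij ◅ ε
    ... | inj₂ (inj₂ (inj₁ r))    = R-sym r ◅ ε
    ... | inj₂ (inj₂ (inj₂ r))    = R-sym r ◅ R-sym rij ◅ ε
  ... | h , far =
    h , far ∘′ inj₁ , far ∘′ inj₂ ∘′ inj₁ , far ∘′ inj₂ ∘′ inj₂ ∘′ inj₁ , far ∘′ inj₂ ∘′ inj₂ ∘′ inj₂

-- Holes through two paths

module PathFamily {V : Set} (E : V → V → Set)
  (E-sym : ∀ {x y} → E x y → E y x) (E-irrefl : ∀ {x} → ¬ E x x)
  {I : Set} (EA EB : I → I → Set) {len : I → ℕ} (path : (u : I) → Vector V (suc (len u)))
  (1≤len : ∀ u → 1 ≤ len u)
  (path-injective : ∀ {u s t} → path u s ≡ path u t → s ≡ t)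
  (path-distinct : ∀ {u w s t} → u ≢ w → path u s ≢ path w t)
  (E-path-same : ∀ {u s t} → E (path u s) (path u t) ⇔ Consec s t)
  (E-path-distinct : ∀ {u w s t} → u ≢ w → E (path u s) (path w t) ⇔ EndAdjacent EA EB u w s t)
  where

  open InducedPaths E E-sym E-irrefl public

  path-inducedPath : ∀ u → IsInducedPath (path u)
  path-inducedPath u = record
    { injective   = λ _ _ → path-injective
    ; edge⇔consec = λ _ _ → E-path-same
    }

  E-first : ∀ {u w t} → u ≢ w → EA u w → E (path u zero) (path w t) ⇔ IsFirst t
  E-first {u} u≢w r = ⇔-trans (E-path-distinct u≢w) (mk⇔
    (λ { (inj₁ (_ , t₀ , _)) → t₀ ; (inj₂ (0ₗ , _)) → ⊥-elim (¬IsLast-zero (1≤len u) 0ₗ) })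
    (λ t₀ → inj₁ (refl , t₀ , r)))

  E-last : ∀ {u w t} → u ≢ w → EB u w → E (path u (fromℕ (len u))) (path w t) ⇔ IsLast t
  E-last {u} u≢w r = ⇔-trans (E-path-distinct u≢w) (mk⇔
    (λ { (inj₁ (L₀ , _)) → ⊥-elim (¬IsFirst-fromℕ (1≤len u) L₀) ; (inj₂ (_ , tₗ , _)) → tₗ })
    (λ tₗ → inj₂ (IsLast-fromℕ (len u) , tₗ , r)))

  through-B : ∀ {u w} → u ≢ w → ¬ EA u w → EB u w → IsInducedPath (path u ++ path w ∘ opposite)
  through-B {u} {w} u≢w ¬a b =
    ++-inducedPath (λ _ _ → path-distinct u≢w) cross (path-inducedPath u) (reverse (path-inducedPath w))
    where
    cross : ∀ s t → E (path u s) (path w (opposite t)) ⇔ (IsLast s × IsFirst t)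
    cross s t = ⇔-trans (E-path-distinct u≢w) (mk⇔
      (λ { (inj₁ (_ , _ , a)) → ⊥-elim (¬a a)
         ; (inj₂ (sₗ , tₗ , _)) → sₗ , Equivalence.to IsLast-opposite tₗ })
      (λ (sₗ , t₀) → inj₂ (sₗ , Equivalence.from IsLast-opposite t₀ , b)))

  through-A : ∀ {u w} → u ≢ w → EA u w → ¬ EB u w → IsInducedPath (path u ∘ opposite ++ path w)
  through-A {u} {w} u≢w a ¬b =
    ++-inducedPath (λ _ _ → path-distinct u≢w) cross (reverse (path-inducedPath u)) (path-inducedPath w)
    where
    cross : ∀ s t → E (path u (opposite s)) (path w t) ⇔ (IsLast s × IsFirst t)
    cross s t = ⇔-trans (E-path-distinct u≢w) (mk⇔
      (λ { (inj₁ (s₀ , t₀ , _)) → Equivalence.to IsFirst-opposite s₀ , t₀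
         ; (inj₂ (_ , _ , b)) → ⊥-elim (¬b b) })
      (λ (sₗ , t₀) → inj₁ (Equivalence.from IsFirst-opposite sₗ , t₀ , a)))

  private
    3≤size : ∀ u w → 3 ≤ suc (len u) + suc (len w)
    3≤size u w = s≤s (+-mono-≤ (1≤len u) (s≤s z≤n))

  hole-through-B : ∀ {x u w} → u ≢ w → ¬ EA u w → EB u w →
    (∀ s → x ≢ path u s) → (∀ t → x ≢ path w t) →
    (∀ s → E x (path u s) ⇔ IsFirst s) → (∀ t → E x (path w t) ⇔ IsFirst t) →
    HoleContaining x (path u) (path w)
  hole-through-B {u = u} {w} u≢w ¬a b x∉u x∉w Exu Exw =
    reverseʳ (∷-++-hole (s≤s z≤n) (s≤s z≤n) (3≤size u w) x∉u (x∉w ∘ opposite)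
      Exu (λ t → ⇔-trans (Exw (opposite t)) IsFirst-opposite) (through-B u≢w ¬a b))

  hole-through-A : ∀ {x u w} → u ≢ w → EA u w → ¬ EB u w →
    (∀ s → x ≢ path u s) → (∀ t → x ≢ path w t) →
    (∀ s → E x (path u s) ⇔ IsLast s) → (∀ t → E x (path w t) ⇔ IsLast t) →
    HoleContaining x (path u) (path w)
  hole-through-A {u = u} {w} u≢w a ¬b x∉u x∉w Exu Exw =
    reverseˡ (∷-++-hole (s≤s z≤n) (s≤s z≤n) (3≤size u w) (x∉u ∘ opposite) x∉w
      (λ s → ⇔-trans (Exu (opposite s)) IsLast-opposite) Exw (through-A u≢w a ¬b))

  -- The cycle starts at the first vertex of path u; the EA-edge between the first ends closes it.
  hole-through-both : ∀ {u w} → u ≢ w → EA u w → EB u w →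
    HoleContaining (path u zero) (path u ∘ suc) (path w)
  hole-through-both {u} {w} u≢w a b = reverseʳ (∷-++-hole (1≤len u) (s≤s z≤n)
    (+-mono-≤ (1≤len u) (s≤s (1≤len w)))
    (λ _ → 0≢1+n ∘ path-injective) (λ _ → path-distinct u≢w)
    (λ _ → ⇔-trans E-path-same Consec-zero-suc) (λ t → ⇔-trans (E-first u≢w a) IsFirst-opposite)
    (++-inducedPath (λ _ _ → path-distinct u≢w) cross
      (tail (path-inducedPath u)) (reverse (path-inducedPath w))))
    where
    cross : ∀ s t → E (path u (suc s)) (path w (opposite t)) ⇔ (IsLast s × IsFirst t)
    cross s t = ⇔-trans (E-path-distinct u≢w) (mk⇔
      (λ { (inj₁ (() , _))
         ; (inj₂ (sₗ , tₗ , _)) → Equivalence.to IsLast-suc sₗ , Equivalence.to IsLast-opposite tₗ })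
      (λ (sₗ , t₀) → inj₂ (Equivalence.from IsLast-suc sₗ , Equivalence.from IsLast-opposite t₀ , b)))

-- Odd frames

module OddFrame {ℓ k : ℕ} {A : Fin k → Fin k → Bool} (hyp : Odd.Hyp ℓ k A) where
  open Odd ℓ k A
  open Odd.Hyp hyp

  1≤L : 1 ≤ L
  1≤L = helper ℓ ℓ≥5
    where
    helper : ∀ m → 5 ≤ m → 1 ≤ ⌊ m ∸ 3 /2⌋
    helper _ (s≤s (s≤s (s≤s (s≤s (s≤s _))))) = s≤s z≤n

  EA-sym : ∀ {i j} → EA i j → EA j i
  EA-sym {i} {j} rewrite A-sym i j = λ r → r

  EB-sym : ∀ {i j} → EB i j → EB j i
  EB-sym {i} {j} (i≢j , r) rewrite A-sym i j = i≢j ∘ sym , r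

  EA-irrefl : ∀ i → ¬ EA i i
  EA-irrefl i rewrite A-irrefl i = λ ()

  EB-irrefl : ∀ i → ¬ EB i i
  EB-irrefl _ (i≢i , _) = i≢i refl

  EA? : ∀ i j → Dec (EA i j)
  EA? i j = T? (A i j)

  EB? : ∀ i j → Dec (EB i j)
  EB? i j = ¬? (i ≟ j) ×-dec T? (not (A i j))

  ¬EA⇒EB : ∀ {i j} → i ≢ j → ¬ EA i j → EB i j
  ¬EA⇒EB {i} {j} i≢j ¬a = i≢j , Equivalence.from (T-not (A i j)) ¬a

  ¬EB⇒EA : ∀ {i j} → i ≢ j → ¬ EB i j → EA i j
  ¬EB⇒EA {i} {j} i≢j ¬b with EA? i j
  ... | yes a  = a
  ... | no ¬a  = ⊥-elim (¬b (¬EA⇒EB i≢j ¬a))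

  EB⇒¬EA : ∀ {i j} → EB i j → ¬ EA i j
  EB⇒¬EA {i} {j} (_ , r) = Equivalence.to (T-not (A i j)) r

  PathE-sym : ∀ {x y} → PathE x y → PathE y x
  PathE-sym {pv _ _} {pv _ _} (e , c) = sym e , ConsecNat-sym c

  PathE-irrefl : ∀ {x} → ¬ PathE x x
  PathE-irrefl {pv _ _} (_ , c) = ConsecNat-irrefl c

  ApexE-irrefl : ∀ {x} → ¬ ApexE x x
  ApexE-irrefl {apex} (inj₁ ((_ , ()) , _))
  ApexE-irrefl {apex} (inj₂ ((_ , ()) , _))

  open FrameEdges PathE toA EA toB EB ApexE

  E-sym : ∀ {x y} → E x y → E y x
  E-sym = Edge-sym PathE-sym EA-sym EB-sym

  E-irrefl : ∀ {x} → ¬ E x x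
  E-irrefl = Edge-irrefl PathE-irrefl EA-irrefl EB-irrefl ApexE-irrefl

  PathE-pv-same : ∀ {i s t} → PathE (pv i s) (pv i t) ⇔ Consec s t
  PathE-pv-same = mk⇔ proj₂ (refl ,_)

  PathE-pv-distinct : ∀ {i j s t} → i ≢ j → ¬ PathE (pv i s) (pv j t)
  PathE-pv-distinct i≢j (i≡j , _) = i≢j i≡j

  toA-pv : ∀ i s {p} → toA (pv i s) ≡ just p ⇔ (i ≡ p × IsFirst s)
  toA-pv _ s = if-first-just s

  toB-pv : ∀ i s {q} → toB (pv i s) ≡ just q ⇔ (i ≡ q × IsLast s)
  toB-pv _ s = if-last-just s

  ¬ApexE-pv : ∀ i s y → ¬ ApexE (pv i s) y
  ¬ApexE-pv _ _ _ ()

  pv-injective : ∀ {i s t} → pv i s ≡ pv i t → s ≡ t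
  pv-injective refl = refl

  pv-distinct : ∀ {i j s t} → i ≢ j → pv i s ≢ pv j t
  pv-distinct i≢j refl = i≢j refl

  open OnPaths EA-irrefl EB-irrefl pv PathE-pv-same PathE-pv-distinct toA-pv toB-pv ¬ApexE-pv

  open PathFamily E E-sym E-irrefl EA EB pv (const 1≤L) pv-injective pv-distinct
    Edge-path-same Edge-path-distinct
  open HoleContaining

  E-apex : ∀ {i s} → E apex (pv i s) ⇔ ((IsFirst s × Disconnected EA) ⊎ (IsLast s × Disconnected EB))
  E-apex = mk⇔ to from
    where
    to : ∀ {i s} → E apex (pv i s) → (IsFirst s × Disconnected EA) ⊎ (IsLast s × Disconnected EB)
    to (A-edge (_ , _ , () , _))
    to (B-edge (_ , _ , () , _))
    to {i} {s} (apex-edgeˡ (inj₁ ((_ , e) , d))) = inj₁ (proj₂ (Equivalence.to (toA-pv i s) e) , d)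
    to {i} {s} (apex-edgeˡ (inj₂ ((_ , e) , d))) = inj₂ (proj₂ (Equivalence.to (toB-pv i s) e) , d)
    to (apex-edgeʳ ())
    from : ∀ {i s} → (IsFirst s × Disconnected EA) ⊎ (IsLast s × Disconnected EB) → E apex (pv i s)
    from {i} {s} (inj₁ (s₀ , d)) = apex-edgeˡ (inj₁ ((i , Equivalence.from (toA-pv i s) (refl , s₀)) , d))
    from {i} {s} (inj₂ (sₗ , d)) = apex-edgeˡ (inj₂ ((i , Equivalence.from (toB-pv i s) (refl , sₗ)) , d))

  module _ (around-apex : ∀ i → ∃[ j ] HoleContaining apex (pv i) (pv j))
           (around-two : ∀ {i j} → i ≢ j → ∃[ x ] HoleContaining x (pv i) (pv j)) where

    private
      with-apex : ∀ {u v} i →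
        (∀ {j} (H : HoleContaining apex (pv i) (pv j)) → u ∈ᵥ cycle H × v ∈ᵥ cycle H) →
        HoleThrough E u v
      with-apex i pick with around-apex i
      ... | _ , H = uncurry (holeThrough H) (pick H)

    cover : ∀ u v → HoleThrough E u v
    cover apex     apex     = with-apex (fromℕ< (≤-trans (s≤s z≤n) k≥3)) λ H → ∋x H , ∋x H
    cover apex     (pv i s) = with-apex i λ H → ∋x H , ⊇g H (∈-self _ s)
    cover (pv i s) apex     = with-apex i λ H → ⊇g H (∈-self _ s) , ∋x H
    cover (pv i s) (pv j t) with i ≟ j
    ... | yes refl = with-apex i λ H → ⊇g H (∈-self _ s) , ⊇g H (∈-self _ t)
    ... | no i≢j with around-two i≢j
    ...   | _ , H = holeThrough H (⊇g H (∈-self _ s)) (⊇h H (∈-self _ t))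

  module _ (DA : Disconnected EA) (¬DB : ¬ Disconnected EB) where

    E-apex-a : ∀ {i s} → E apex (pv i s) ⇔ IsFirst s
    E-apex-a = ⇔-trans E-apex (mk⇔
      (λ { (inj₁ (s₀ , _)) → s₀ ; (inj₂ (_ , DB)) → ⊥-elim (¬DB DB) })
      (λ s₀ → inj₁ (s₀ , DA)))

    apex-hole-A : ∀ {i j} → i ≢ j → ¬ EA i j → HoleContaining apex (pv i) (pv j)
    apex-hole-A i≢j ¬a =
      hole-through-B i≢j ¬a (¬EA⇒EB i≢j ¬a) (λ _ ()) (λ _ ()) (λ _ → E-apex-a) (λ _ → E-apex-a)

    around-apex-A : ∀ i → ∃[ j ] HoleContaining apex (pv i) (pv j)
    around-apex-A i with disconnected⇒non-neighbour EA-sym EA? DA i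
    ... | j , j≢i , ¬a = j , apex-hole-A (j≢i ∘ sym) ¬a

    around-two-A : ∀ {i j} → i ≢ j → ∃[ x ] HoleContaining x (pv i) (pv j)
    around-two-A {i} {j} i≢j with EA? i j
    ... | no ¬a = apex , apex-hole-A i≢j ¬a
    ... | yes a with disconnected⇒common-non-neighbour EA-sym EA? DA a
    ...   | h , h≢i , h≢j , ¬ih , ¬jh =
      pv h (fromℕ L) ,
      hole-through-A i≢j a (λ b → EB⇒¬EA b a) (λ _ → pv-distinct h≢i) (λ _ → pv-distinct h≢j)
        (λ _ → E-last h≢i (¬EA⇒EB h≢i (¬ih ∘ EA-sym)))
        (λ _ → E-last h≢j (¬EA⇒EB h≢j (¬jh ∘ EA-sym)))

  module _ (¬DA : ¬ Disconnected EA) (DB : Disconnected EB) where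

    E-apex-b : ∀ {i s} → E apex (pv i s) ⇔ IsLast s
    E-apex-b = ⇔-trans E-apex (mk⇔
      (λ { (inj₁ (_ , DA)) → ⊥-elim (¬DA DA) ; (inj₂ (sₗ , _)) → sₗ })
      (λ sₗ → inj₂ (sₗ , DB)))

    apex-hole-B : ∀ {i j} → i ≢ j → EA i j → HoleContaining apex (pv i) (pv j)
    apex-hole-B i≢j a =
      hole-through-A i≢j a (λ b → EB⇒¬EA b a) (λ _ ()) (λ _ ()) (λ _ → E-apex-b) (λ _ → E-apex-b)

    around-apex-B : ∀ i → ∃[ j ] HoleContaining apex (pv i) (pv j)
    around-apex-B i with disconnected⇒non-neighbour EB-sym EB? DB i
    ... | j , j≢i , ¬b = j , apex-hole-B (j≢i ∘ sym) (¬EB⇒EA (j≢i ∘ sym) ¬b)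

    around-two-B : ∀ {i j} → i ≢ j → ∃[ x ] HoleContaining x (pv i) (pv j)
    around-two-B {i} {j} i≢j with EA? i j
    ... | yes a = apex , apex-hole-B i≢j a
    ... | no ¬a with disconnected⇒common-non-neighbour EB-sym EB? DB (¬EA⇒EB i≢j ¬a)
    ...   | h , h≢i , h≢j , ¬ih , ¬jh =
      pv h zero ,
      hole-through-B i≢j ¬a (¬EA⇒EB i≢j ¬a) (λ _ → pv-distinct h≢i) (λ _ → pv-distinct h≢j)
        (λ _ → E-first h≢i (¬EB⇒EA h≢i (¬ih ∘ EB-sym)))
        (λ _ → E-first h≢j (¬EB⇒EA h≢j (¬jh ∘ EB-sym)))

  holeThrough-all : ∀ u v → HoleThrough E u v
  holeThrough-all with exactly-one
  ... | inj₁ (DA , ¬DB) = cover (around-apex-A DA ¬DB) (around-two-A DA ¬DB)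
  ... | inj₂ (¬DA , DB) = cover (around-apex-B ¬DA DB) (around-two-B ¬DA DB)

-- Even frames

other : ∀ {n} → 2 ≤ n → (i : Fin n) → ∃[ i′ ] i ≢ i′
other {suc (suc _)} _ zero    = suc zero , λ ()
other {suc (suc _)} _ (suc _) = zero , λ ()
other {suc zero}    (s≤s ()) zero

module EvenFrame {ℓ n m : ℕ} {AC : Fin n → Fin m → Bool} (hyp : Even.Hyp ℓ n m AC) where
  open Even ℓ n m AC
  open Even.Hyp hyp

  len : AV → ℕ
  len (inj₁ _) = LP
  len (inj₂ _) = LQ

  path : (u : AV) → Vector V (suc (len u))
  path (inj₁ i) = pP i
  path (inj₂ j) = pQ j

  1≤len : ∀ u → 1 ≤ len u
  1≤len (inj₁ _) = helper ℓ ℓ≥6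
    where
    helper : ∀ q → 6 ≤ q → 1 ≤ ⌊ q /2⌋ ∸ 2
    helper _ (s≤s (s≤s (s≤s (s≤s (s≤s (s≤s _)))))) = s≤s z≤n
  1≤len (inj₂ _) = helper ℓ ℓ≥6
    where
    helper : ∀ q → 6 ≤ q → 1 ≤ ⌊ q /2⌋ ∸ 1
    helper _ (s≤s (s≤s (s≤s (s≤s (s≤s (s≤s _)))))) = s≤s z≤n

  EA-sym : ∀ {u w} → EA u w → EA w u
  EA-sym {inj₁ _} {inj₂ _} r = r
  EA-sym {inj₂ _} {inj₁ _} r = r
  EA-sym {inj₂ _} {inj₂ _} r = r ∘ sym

  EB-sym : ∀ {u w} → EB u w → EB w u
  EB-sym {inj₁ _} {inj₂ _} r = r
  EB-sym {inj₂ _} {inj₁ _} r = r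
  EB-sym {inj₂ _} {inj₂ _} r = r ∘ sym

  EA-irrefl : ∀ u → ¬ EA u u
  EA-irrefl (inj₂ _) r = r refl

  EB-irrefl : ∀ u → ¬ EB u u
  EB-irrefl (inj₂ _) r = r refl

  PathE-sym : ∀ {x y} → PathE x y → PathE y x
  PathE-sym {pP _ _} {pP _ _} (e , c) = sym e , ConsecNat-sym c
  PathE-sym {pQ _ _} {pQ _ _} (e , c) = sym e , ConsecNat-sym c

  PathE-irrefl : ∀ {x} → ¬ PathE x x
  PathE-irrefl {pP _ _} (_ , c) = ConsecNat-irrefl c
  PathE-irrefl {pQ _ _} (_ , c) = ConsecNat-irrefl c

  ApexE-irrefl : ∀ {x} → ¬ ApexE x x
  ApexE-irrefl {apexA} (_ , ())
  ApexE-irrefl {apexB} (_ , ())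

  open FrameEdges PathE toA EA toB EB ApexE

  E-sym : ∀ {x y} → E x y → E y x
  E-sym = Edge-sym PathE-sym (λ {u} {w} → EA-sym {u} {w}) (λ {u} {w} → EB-sym {u} {w})

  E-irrefl : ∀ {x} → ¬ E x x
  E-irrefl = Edge-irrefl PathE-irrefl EA-irrefl EB-irrefl ApexE-irrefl

  PathE-path-same : ∀ {u s t} → PathE (path u s) (path u t) ⇔ Consec s t
  PathE-path-same {inj₁ _} = mk⇔ proj₂ (refl ,_)
  PathE-path-same {inj₂ _} = mk⇔ proj₂ (refl ,_)

  PathE-path-distinct : ∀ {u w s t} → u ≢ w → ¬ PathE (path u s) (path w t)
  PathE-path-distinct {inj₁ _} {inj₁ _} u≢w (refl , _) = u≢w refl
  PathE-path-distinct {inj₂ _} {inj₂ _} u≢w (refl , _) = u≢w refl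

  toA-path : ∀ u s {p} → toA (path u s) ≡ just p ⇔ (u ≡ p × IsFirst s)
  toA-path (inj₁ _) s = if-first-just s
  toA-path (inj₂ _) s = if-first-just s

  toB-path : ∀ u s {q} → toB (path u s) ≡ just q ⇔ (u ≡ q × IsLast s)
  toB-path (inj₁ _) s = if-last-just s
  toB-path (inj₂ _) s = if-last-just s

  ¬ApexE-path : ∀ u s y → ¬ ApexE (path u s) y
  ¬ApexE-path (inj₁ _) _ _ ()
  ¬ApexE-path (inj₂ _) _ _ ()

  path-injective : ∀ {u s t} → path u s ≡ path u t → s ≡ t
  path-injective {inj₁ _} refl = refl
  path-injective {inj₂ _} refl = refl

  path-distinct : ∀ {u w s t} → u ≢ w → path u s ≢ path w t
  path-distinct {inj₁ _} {inj₁ _} u≢w refl = u≢w refl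
  path-distinct {inj₂ _} {inj₂ _} u≢w refl = u≢w refl

  open OnPaths EA-irrefl EB-irrefl path PathE-path-same PathE-path-distinct toA-path toB-path ¬ApexE-path

  open PathFamily E E-sym E-irrefl EA EB path 1≤len path-injective path-distinct
    Edge-path-same Edge-path-distinct
  open HoleContaining

  E-apexA : ∀ u {s} → E apexA (path u s) ⇔ IsFirst s
  E-apexA u {s} = mk⇔ to (λ s₀ → apex-edgeˡ (_ , Equivalence.from (toA-path u s) (refl , s₀)))
    where
    to : E apexA (path u s) → IsFirst s
    to (A-edge (_ , _ , () , _))
    to (B-edge (_ , _ , () , _))
    to (apex-edgeˡ (_ , e)) = proj₂ (Equivalence.to (toA-path u s) e)
    to (apex-edgeʳ e)       = ⊥-elim (¬ApexE-path u s _ e)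

  E-apexB : ∀ u {s} → E apexB (path u s) ⇔ IsLast s
  E-apexB u {s} = mk⇔ to (λ sₗ → apex-edgeˡ (_ , Equivalence.from (toB-path u s) (refl , sₗ)))
    where
    to : E apexB (path u s) → IsLast s
    to (A-edge (_ , _ , () , _))
    to (B-edge (_ , _ , () , _))
    to (apex-edgeˡ (_ , e)) = proj₂ (Equivalence.to (toB-path u s) e)
    to (apex-edgeʳ e)       = ⊥-elim (¬ApexE-path u s _ e)

  ¬E-apexA-apexB : ¬ E apexA apexB
  ¬E-apexA-apexB (A-edge (_ , _ , () , _))
  ¬E-apexA-apexB (B-edge (_ , _ , () , _))
  ¬E-apexA-apexB (apex-edgeˡ (_ , ()))
  ¬E-apexA-apexB (apex-edgeʳ (_ , ()))

  hole-via-apexes : ∀ {i i′} → i ≢ i′ → HoleContaining apexA (pP i) (apexB ∷ pP i′ ∘ opposite)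
  hole-via-apexes {i} {i′} i≢i′ = ∷-++-hole (s≤s z≤n) (s≤s z≤n) 3≤size
    (λ _ ()) (λ { zero () ; (suc _) () }) (λ _ → E-apexA (inj₁ i)) E-apexA-tail
    (++-inducedPath disjoint cross (path-inducedPath (inj₁ i)) tail-inducedPath)
    where
    u≢w : inj₁ i ≢ inj₁ i′
    u≢w refl = i≢i′ refl
    3≤size : 3 ≤ suc LP + suc (suc LP)
    3≤size = s≤s (≤-trans (s≤s (s≤s z≤n)) (m≤n+m (suc (suc LP)) LP))
    tail-inducedPath : IsInducedPath (apexB ∷ pP i′ ∘ opposite)
    tail-inducedPath = ∷-inducedPath (λ _ ()) (λ _ → ⇔-trans (E-apexB (inj₁ i′)) IsLast-opposite)
      (reverse (path-inducedPath (inj₁ i′)))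
    disjoint : ∀ s t → pP i s ≢ (apexB ∷ pP i′ ∘ opposite) t
    disjoint s zero    ()
    disjoint s (suc t) = path-distinct u≢w
    a-stable : ∀ {s t} → ¬ E (pP i s) (pP i′ t)
    a-stable e with Equivalence.to (Edge-path-distinct u≢w) e
    ... | inj₁ (_ , _ , ())
    ... | inj₂ (_ , _ , ())
    cross : ∀ s t → E (pP i s) ((apexB ∷ pP i′ ∘ opposite) t) ⇔ (IsLast s × IsFirst t)
    cross s zero    = mk⇔ (λ e → Equivalence.to (E-apexB (inj₁ i)) (E-sym {pP i s} {apexB} e) , refl)
                          (E-sym {apexB} {pP i s} ∘ Equivalence.from (E-apexB (inj₁ i)) ∘ proj₁)
    cross s (suc t) = mk⇔ (⊥-elim ∘ a-stable) (λ { (_ , ()) })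
    E-apexA-tail : ∀ t → E apexA ((apexB ∷ pP i′ ∘ opposite) t) ⇔ IsLast t
    E-apexA-tail zero    = mk⇔ (⊥-elim ∘ ¬E-apexA-apexB) (⊥-elim ∘ ¬IsLast-zero (s≤s z≤n))
    E-apexA-tail (suc t) = ⇔-trans (E-apexA (inj₁ i′)) (⇔-trans IsFirst-opposite (⇔-sym IsLast-suc))

  hole-via-apexA : ∀ {i j} → ¬ T (AC i j) → HoleContaining apexA (pQ j) (pP i)
  hole-via-apexA {i} {j} ¬a = hole-through-B (λ ()) ¬a (Equivalence.from (T-not (AC i j)) ¬a)
    (λ _ ()) (λ _ ()) (λ _ → E-apexA (inj₂ j)) (λ _ → E-apexA (inj₁ i))

  hole-via-apexB : ∀ {i j} → T (AC i j) → HoleContaining apexB (pQ j) (pP i)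
  hole-via-apexB {i} {j} a = hole-through-A (λ ()) a (λ b → Equivalence.to (T-not (AC i j)) b a)
    (λ _ ()) (λ _ ()) (λ _ → E-apexB (inj₂ j)) (λ _ → E-apexB (inj₁ i))

  hole-via-c-and-d : ∀ {j j′} → j ≢ j′ → HoleContaining (pQ j zero) (pQ j ∘ suc) (pQ j′)
  hole-via-c-and-d j≢j′ = hole-through-both (λ { refl → j≢j′ refl }) j≢j′ j≢j′

  private
    ia ib : Fin n
    ia = proj₁ a-deg0
    ib = proj₁ b-deg0

    ¬AC-ia : ∀ j → ¬ T (AC ia j)
    ¬AC-ia j = proj₂ a-deg0 (inj₂ j)

    AC-ib : ∀ j → T (AC ib j)
    AC-ib j = ¬T-not⇒T (AC ib j) (proj₂ b-deg0 (inj₂ j))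

    via-apexes : ∀ {u v} i →
      (∀ {i′} (H : HoleContaining apexA (pP i) (apexB ∷ pP i′ ∘ opposite)) →
        u ∈ᵥ cycle H × v ∈ᵥ cycle H) →
      HoleThrough E u v
    via-apexes i pick with other n≥2 i
    ... | _ , i≢i′ = uncurry (holeThrough H) (pick H)
      where H = hole-via-apexes i≢i′

    apexB∈ : ∀ {i i′} (H : HoleContaining apexA (pP i) (apexB ∷ pP i′ ∘ opposite)) →
             apexB ∈ᵥ cycle H
    apexB∈ H = ⊇h H ∈-here

    P-P : ∀ i s i′ t → HoleThrough E (pP i s) (pP i′ t)
    P-P i s i′ t with i ≟ i′
    ... | yes refl = via-apexes i λ H → ⊇g H (∈-self _ s) , ⊇g H (∈-self _ t)
    ... | no i≢i′  = holeThrough H (⊇g H (∈-self _ s)) (⊇h H (∈-there (∈-reverse (∈-self _ t))))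
      where H = hole-via-apexes i≢i′

    A-Q : ∀ j t → HoleThrough E apexA (pQ j t)
    A-Q j t = holeThrough H (∋x H) (⊇g H (∈-self _ t))
      where H = hole-via-apexA (¬AC-ia j)

    B-Q : ∀ j t → HoleThrough E apexB (pQ j t)
    B-Q j t = holeThrough H (∋x H) (⊇g H (∈-self _ t))
      where H = hole-via-apexB (AC-ib j)

    P-Q : ∀ i s j t → HoleThrough E (pP i s) (pQ j t)
    P-Q i s j t with T? (AC i j)
    ... | yes a = holeThrough H (⊇h H (∈-self _ s)) (⊇g H (∈-self _ t))
      where H = hole-via-apexB a
    ... | no ¬a = holeThrough H (⊇h H (∈-self _ s)) (⊇g H (∈-self _ t))
      where H = hole-via-apexA ¬a

    Q-Q : ∀ j t j′ t′ → HoleThrough E (pQ j t) (pQ j′ t′)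
    Q-Q j t j′ t′ with j ≟ j′
    ... | yes refl = holeThrough H (⊇g H (∈-self _ t)) (⊇g H (∈-self _ t′))
      where H = hole-via-apexA (¬AC-ia j)
    ... | no j≢j′ =
      holeThrough H (⊆-head-tail {g = pQ j} (∋x H) (⊇g H) (∈-self _ t)) (⊇h H (∈-self _ t′))
      where H = hole-via-c-and-d j≢j′

  holeThrough-all : ∀ u v → HoleThrough E u v
  holeThrough-all apexA    apexA     = via-apexes ia λ H → ∋x H , ∋x H
  holeThrough-all apexA    apexB     = via-apexes ia λ H → ∋x H , apexB∈ H
  holeThrough-all apexB    apexA     = via-apexes ia λ H → apexB∈ H , ∋x H
  holeThrough-all apexB    apexB     = via-apexes ia λ H → apexB∈ H , apexB∈ H
  holeThrough-all apexA    (pP i s)  = via-apexes i λ H → ∋x H , ⊇g H (∈-self _ s)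
  holeThrough-all (pP i s) apexA     = via-apexes i λ H → ⊇g H (∈-self _ s) , ∋x H
  holeThrough-all apexB    (pP i s)  = via-apexes i λ H → apexB∈ H , ⊇g H (∈-self _ s)
  holeThrough-all (pP i s) apexB     = via-apexes i λ H → ⊇g H (∈-self _ s) , apexB∈ H
  holeThrough-all (pP i s) (pP i′ t) = P-P i s i′ t
  holeThrough-all apexA    (pQ j t)  = A-Q j t
  holeThrough-all (pQ j t) apexA     = holeThrough-sym (A-Q j t)
  holeThrough-all apexB    (pQ j t)  = B-Q j t
  holeThrough-all (pQ j t) apexB     = holeThrough-sym (B-Q j t)
  holeThrough-all (pP i s) (pQ j t)  = P-Q i s j t
  holeThrough-all (pQ j t) (pP i s)  = holeThrough-sym (P-Q i s j t)
  holeThrough-all (pQ j t) (pQ j′ t′) = Q-Q j t j′ t′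

mainTheorem12 :
    ((ℓ k : ℕ) (A : Fin k → Fin k → Bool) → Odd.Hyp ℓ k A →
      (u v : Odd.V ℓ k A) → HoleThrough (Odd.E ℓ k A) u v)
    ×
    ((ℓ n m : ℕ) (AC : Fin n → Fin m → Bool) → Even.Hyp ℓ n m AC →
      (u v : Even.V ℓ n m AC) → HoleThrough (Even.E ℓ n m AC) u v)
mainTheorem12 =
  (λ _ _ _ hyp → OddFrame.holeThrough-all hyp) ,
  (λ _ _ _ _ hyp → EvenFrame.holeThrough-all hyp)
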